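{- For every positive integer $n$ and every integer $k\geq2$ there exists a divisor $d\mid n$ with $d\leq n^{1/k}$ and \[ \tau(n)\leq 2^{k^2}\tau(d)^{k^3}, \] where $\tau$ denotes the number-of-divisors function. -}

module Defs where

open import Data.Nat using (ℕ; suc)
open import Data.Nat.Divisibility using (_∣?_)
open import Data.List using (length; filter; map; upTo)

τ : ℕ → ℕ
τ n = length (filter (_∣? n) (map suc (upTo n)))

{-# OPTIONS --safe #-}
-- Peel off the prime powers of n in increasing order of the primes. For the part m already
-- treated and a lower bound q for its primes, keep a divisor d of m and an excess exponent u < k
-- with d^k q^u ≤ m and τ(m) ≤ 2^u τ(d)^(k³). To add p^a with p at most the primes of m, write
-- u + a = c k + u′ with u′ < k and replace d by p^c d: τ gains the factor 1 + a, τ(d) the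
-- factor 1 + c, and (1 + a) 2^u ≤ 2^u′ (1 + c)^(k³). At the end take q = 1 and use u < k ≤ k².
module Submission where

open import Data.Bool.Base using (Bool; true; false)
open import Data.List.Base using (_++_; [_]; length; filter; map; upTo; applyUpTo)
open import Data.List.Properties using (applyUpTo-∷ʳ; map-++; filter-++; length-++)
open import Data.Nat
open import Data.Nat.Coprimality using (Coprime; coprime-divisor)
open import Data.Nat.Divisibility
open import Data.Nat.DivMod using (_/_; _%_; m≡m%n+[m/n]*n; m%n<n)
open import Data.Nat.Induction using (<-rec)
open import Data.Nat.Primality
  using (Prime; _Rough_; 1-rough; 2-rough; ∤⇒rough-suc; rough∧∣⇒rough; rough∧∣⇒prime; rough⇒≤
        ; prime⇒nonZero; prime⇒nonTrivial; prime⇒irreducible)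
open import Data.Nat.Properties
open import Algebra.Properties.CommutativeSemigroup +-commutativeSemigroup
  using () renaming (interchange to +-interchange)
open import Algebra.Properties.CommutativeSemigroup *-commutativeSemigroup
  using () renaming (interchange to *-interchange)
open import Data.Nat.Tactic.RingSolver using (solve-∀)
open import Data.Product using (∃-syntax; _×_; _,_; proj₁)
open import Data.Sum using (_⊎_; inj₁; inj₂)
open import Function using (id; _∘_)
open import Function.Bundles using (_⇔_; mk⇔)
open import Level using (0ℓ)
open import Relation.Binary.PropositionalEquality hiding ([_])
open import Relation.Nullary using (¬_; does; yes; no; contradiction)
open import Relation.Nullary.Decidable using (does-⇔; _⊎-dec_; _×-dec_)
open import Relation.Unary using (Pred; Decidable)

open import Defs

toℕ : Bool → ℕ
toℕ false = 0
toℕ true  = 1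

count : {P : Pred ℕ 0ℓ} → Decidable P → ℕ → ℕ
count P? zero    = 0
count P? (suc N) = count P? N + toℕ (does (P? (suc N)))

module _ {P : Pred ℕ 0ℓ} (P? : Decidable P) where

  length-filter-[_] : ∀ x → length (filter P? [ x ]) ≡ toℕ (does (P? x))
  length-filter-[ x ] with does (P? x)
  ... | true  = refl
  ... | false = refl

  length-filter-upTo : ∀ N → length (filter P? (map suc (upTo N))) ≡ count P? N
  length-filter-upTo zero    = refl
  length-filter-upTo (suc N) = begin
    length (filter P? (map suc (applyUpTo id (suc N))))
      ≡⟨ cong (length ∘ filter P? ∘ map suc) (applyUpTo-∷ʳ id N) ⟨
    length (filter P? (map suc (upTo N ++ [ N ])))
      ≡⟨ cong (length ∘ filter P?) (map-++ suc (upTo N) [ N ]) ⟩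
    length (filter P? (map suc (upTo N) ++ [ suc N ]))
      ≡⟨ cong length (filter-++ P? (map suc (upTo N)) [ suc N ]) ⟩
    length (filter P? (map suc (upTo N)) ++ filter P? [ suc N ])
      ≡⟨ length-++ (filter P? (map suc (upTo N))) ⟩
    length (filter P? (map suc (upTo N))) + length (filter P? [ suc N ])
      ≡⟨ cong₂ _+_ (length-filter-upTo N) length-filter-[ suc N ] ⟩
    count P? (suc N) ∎
    where open ≡-Reasoning

  count-+ : ∀ M j → count P? (j + M) ≡ count P? M + count (λ i → P? (i + M)) j
  count-+ M zero    = sym (+-identityʳ (count P? M))
  count-+ M (suc j) = begin
    count P? (j + M) + toℕ (does (P? (suc j + M)))
      ≡⟨ cong (_+ toℕ (does (P? (suc j + M)))) (count-+ M j) ⟩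
    count P? M + count (λ i → P? (i + M)) j + toℕ (does (P? (suc j + M)))
      ≡⟨ +-assoc (count P? M) _ _ ⟩
    count P? M + count (λ i → P? (i + M)) (suc j) ∎
    where open ≡-Reasoning

  count-none : ∀ j → (∀ i → i < j → ¬ P (suc i)) → count P? j ≡ 0
  count-none zero    _    = refl
  count-none (suc j) none with P? (suc j)
  ... | yes P[1+j] = contradiction P[1+j] (none j ≤-refl)
  ... | no  _      = cong (_+ 0) (count-none j (λ i i<j → none i (m<n⇒m<1+n i<j)))

module _ {P : Pred ℕ 0ℓ} (P? : Decidable P) where

  count-beyond : ∀ {N M} → N ≤ M → (∀ i → N < i → ¬ P i) → count P? M ≡ count P? N
  count-beyond {N} {M} N≤M none = begin
    count P? M                                    ≡⟨ cong (count P?) (m∸n+n≡m N≤M) ⟨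
    count P? (M ∸ N + N)                          ≡⟨ count-+ P? N (M ∸ N) ⟩
    count P? N + count (λ i → P? (i + N)) (M ∸ N) ≡⟨ cong (count P? N +_) none-above-N ⟩
    count P? N + 0                                ≡⟨ +-identityʳ (count P? N) ⟩
    count P? N ∎
    where
    open ≡-Reasoning
    none-above-N : count (λ i → P? (i + N)) (M ∸ N) ≡ 0
    none-above-N = count-none _ (M ∸ N) (λ i _ → none (suc i + N) (s≤s (m≤n+m N i)))

  count-multiples : ∀ s .{{_ : NonZero s}} → (∀ i → P i → s ∣ i) →
                    ∀ N → count P? (N * s) ≡ count (λ j → P? (j * s)) N
  count-multiples s only-multiples zero = refl
  count-multiples s@(suc s′) only-multiples (suc N) = begin
    count P? (s + N * s)
      ≡⟨ count-+ P? (N * s) s ⟩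
    count P? (N * s) + count (λ i → P? (i + N * s)) s
      ≡⟨ cong₂ _+_ (count-multiples s only-multiples N)
                   (cong (_+ toℕ (does (P? (suc N * s)))) no-interior) ⟩
    count (λ j → P? (j * s)) (suc N) ∎
    where
    open ≡-Reasoning
    no-interior : count (λ i → P? (i + N * s)) s′ ≡ 0
    no-interior = count-none _ s′ λ i i<s′ P[1+i+Ns] → <⇒≱ (s≤s i<s′)
      (∣⇒≤ (∣m+n∣m⇒∣n (subst (s ∣_) (+-comm (suc i) (N * s)) (only-multiples _ P[1+i+Ns])) (n∣m*n N)))

module _ {P Q : Pred ℕ 0ℓ} (P? : Decidable P) (Q? : Decidable Q) where

  count-cong : (∀ i → P i ⇔ Q i) → ∀ N → count P? N ≡ count Q? N
  count-cong P⇔Q zero    = refl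
  count-cong P⇔Q (suc N) =
    cong₂ _+_ (count-cong P⇔Q N) (cong toℕ (does-⇔ (P⇔Q (suc N)) (P? (suc N)) (Q? (suc N))))

  count-⊎ : (∀ i → ¬ (P i × Q i)) → ∀ N →
            count (λ i → P? i ⊎-dec Q? i) N ≡ count P? N + count Q? N
  count-⊎ disjoint zero    = refl
  count-⊎ disjoint (suc N) = begin
    count (λ i → P? i ⊎-dec Q? i) N + toℕ (does (P? (suc N) ⊎-dec Q? (suc N)))
      ≡⟨ cong₂ _+_ (count-⊎ disjoint N) (toℕ-⊎ (suc N)) ⟩
    (count P? N + count Q? N) + (toℕ (does (P? (suc N))) + toℕ (does (Q? (suc N))))
      ≡⟨ +-interchange (count P? N) _ _ _ ⟩
    count P? (suc N) + count Q? (suc N) ∎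
    where
    open ≡-Reasoning
    toℕ-⊎ : ∀ i → toℕ (does (P? i ⊎-dec Q? i)) ≡ toℕ (does (P? i)) + toℕ (does (Q? i))
    toℕ-⊎ i with P? i | Q? i
    ... | yes Pi | yes Qi = contradiction (Pi , Qi) (disjoint i)
    ... | yes _  | no  _  = refl
    ... | no  _  | _      = refl

τ≡count : ∀ n → τ n ≡ count (_∣? n) n
τ≡count n = length-filter-upTo (_∣? n) n

∤⇒nonZero : ∀ {p m} → p ∤ m → NonZero m
∤⇒nonZero {p} {zero}  p∤0 = contradiction (p ∣0) p∤0
∤⇒nonZero {p} {suc _} _   = _

module _ {p : ℕ} (p-prime : Prime p) where

  private instance
    p≢0 : NonZero p
    p≢0 = prime⇒nonZero p-prime

  ∤⇒coprime : ∀ {e} → p ∤ e → Coprime e p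
  ∤⇒coprime p∤e (i∣e , i∣p) with prime⇒irreducible p-prime i∣p
  ... | inj₁ i≡1  = i≡1
  ... | inj₂ refl = contradiction i∣e p∤e

  module _ {m : ℕ} (p∤m : p ∤ m) where

    p^[1+a]*m≡p^a*m*p : ∀ a → p ^ suc a * m ≡ p ^ a * m * p
    p^[1+a]*m≡p^a*m*p a = trans (*-assoc p (p ^ a) m) (*-comm p (p ^ a * m))

    ∣p^[1+a]m∧∤p^am⇒p^[1+a]∣ : ∀ a {e} → e ∣ p ^ suc a * m → e ∤ p ^ a * m → p ^ suc a ∣ e
    ∣p^[1+a]m∧∤p^am⇒p^[1+a]∣ a {e} e∣ e∤ with p ∣? e
    ... | no p∤e = contradiction
      (coprime-divisor (∤⇒coprime p∤e) (subst (e ∣_) (*-assoc p (p ^ a) m) e∣)) e∤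
    ∣p^[1+a]m∧∤p^am⇒p^[1+a]∣ zero    e∣ e∤ | yes (divides q refl) =
      subst (_∣ q * p) (sym (*-identityʳ p)) (n∣m*n q)
    ∣p^[1+a]m∧∤p^am⇒p^[1+a]∣ (suc a) e∣ e∤ | yes (divides q refl) =
      subst (_∣ q * p) (*-comm (p ^ suc a) p) (*-monoˡ-∣ p p^[1+a]∣q)
      where
      q∣ : q ∣ p ^ suc a * m
      q∣ = *-cancelʳ-∣ p (subst (q * p ∣_) (p^[1+a]*m≡p^a*m*p (suc a)) e∣)
      q∤ : q ∤ p ^ a * m
      q∤ q∣ = e∤ (subst (q * p ∣_) (sym (p^[1+a]*m≡p^a*m*p a)) (*-monoˡ-∣ p q∣))
      p^[1+a]∣q : p ^ suc a ∣ q
      p^[1+a]∣q = ∣p^[1+a]m∧∤p^am⇒p^[1+a]∣ a q∣ q∤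

    private instance
      m≢0 : NonZero m
      m≢0 = ∤⇒nonZero p∤m

    p^[1+a]∤p^am : ∀ a → p ^ suc a ∤ p ^ a * m
    p^[1+a]∤p^am a p^[1+a]∣ = p∤m (*-cancelˡ-∣ (p ^ a) {{m^n≢0 p a}}
      (subst (_∣ p ^ a * m) (*-comm p (p ^ a)) p^[1+a]∣))

    ∣p^[1+a]m⇔ : ∀ a {e} → e ∣ p ^ suc a * m ⇔ (e ∣ p ^ a * m ⊎ (p ^ suc a ∣ e × e ∣ p ^ suc a * m))
    ∣p^[1+a]m⇔ a {e} = mk⇔ to from
      where
      to : e ∣ p ^ suc a * m → e ∣ p ^ a * m ⊎ (p ^ suc a ∣ e × e ∣ p ^ suc a * m)
      to e∣ with e ∣? p ^ a * m
      ... | yes e∣p^am = inj₁ e∣p^am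
      ... | no  e∤p^am = inj₂ (∣p^[1+a]m∧∤p^am⇒p^[1+a]∣ a e∣ e∤p^am , e∣)
      from : e ∣ p ^ a * m ⊎ (p ^ suc a ∣ e × e ∣ p ^ suc a * m) → e ∣ p ^ suc a * m
      from (inj₁ e∣p^am) = subst (e ∣_) (sym (p^[1+a]*m≡p^a*m*p a)) (∣-trans e∣p^am (m∣m*n p))
      from (inj₂ (_ , e∣)) = e∣

    τ[p^[1+a]m] : ∀ a → τ (p ^ suc a * m) ≡ τ (p ^ a * m) + τ m
    τ[p^[1+a]m] a = begin
      τ X                                    ≡⟨ τ≡count X ⟩
      count (_∣? X) X                        ≡⟨ count-cong _ _ (λ _ → ∣p^[1+a]m⇔ a) X ⟩
      count (λ e → e ∣? A ⊎-dec multiple? e) X ≡⟨ count-⊎ _ _ (λ _ → disjoint) X ⟩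
      count (_∣? A) X + count multiple? X     ≡⟨ cong₂ _+_ divisors-of-A divisors-of-X-above-s ⟩
      τ A + τ m ∎
      where
      open ≡-Reasoning
      s = p ^ suc a
      A = p ^ a * m
      X = s * m
      instance
        s≢0 : NonZero s
        s≢0 = m^n≢0 p (suc a)
        A≢0 : NonZero A
        A≢0 = m*n≢0 (p ^ a) m {{m^n≢0 p a}}
      Multiple : Pred ℕ 0ℓ
      Multiple e = s ∣ e × e ∣ X
      multiple? : Decidable Multiple
      multiple? e = s ∣? e ×-dec e ∣? X
      disjoint : ∀ {e} → ¬ (e ∣ A × Multiple e)
      disjoint (e∣A , s∣e , _) = p^[1+a]∤p^am a (∣-trans s∣e e∣A)
      divisors-of-A : count (_∣? A) X ≡ τ A
      divisors-of-A = trans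
        (count-beyond (_∣? A) A≤X (λ _ → >⇒∤))
        (sym (τ≡count A))
        where
        A≤X : A ≤ X
        A≤X = subst (A ≤_) (sym (*-assoc p (p ^ a) m)) (m≤n*m A p)
      j*s-multiple⇔j∣m : ∀ j → Multiple (j * s) ⇔ j ∣ m
      j*s-multiple⇔j∣m j = mk⇔
        (λ (_ , j*s∣X) → *-cancelʳ-∣ s (subst (j * s ∣_) (*-comm s m) j*s∣X))
        (λ j∣m → n∣m*n j , subst (j * s ∣_) (*-comm m s) (*-monoˡ-∣ s j∣m))
      divisors-of-X-above-s : count multiple? X ≡ τ m
      divisors-of-X-above-s = begin
        count multiple? (s * m)                ≡⟨ cong (count multiple?) (*-comm s m) ⟩
        count multiple? (m * s)                ≡⟨ count-multiples multiple? s (λ _ → proj₁) m ⟩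
        count (λ j → multiple? (j * s)) m      ≡⟨ count-cong _ _ j*s-multiple⇔j∣m m ⟩
        count (_∣? m) m                        ≡⟨ τ≡count m ⟨
        τ m ∎

    τ[p^am] : ∀ a → τ (p ^ a * m) ≡ suc a * τ m
    τ[p^am] zero    = trans (cong τ (*-identityˡ m)) (sym (+-identityʳ (τ m)))
    τ[p^am] (suc a) = begin
      τ (p ^ suc a * m)       ≡⟨ τ[p^[1+a]m] a ⟩
      τ (p ^ a * m) + τ m     ≡⟨ cong (_+ τ m) (τ[p^am] a) ⟩
      suc a * τ m + τ m       ≡⟨ +-comm (suc a * τ m) (τ m) ⟩
      suc (suc a) * τ m ∎
      where open ≡-Reasoning

leastPrimeFactor : ∀ n → .{{NonTrivial n}} → ∃[ p ] (Prime p × p ∣ n × p Rough n)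
leastPrimeFactor n = search 2 (n ∸ 2) (m∸n+n≡m (nonTrivial⇒n>1 n)) 2-rough
  where
  search : ∀ m gap → .{{NonTrivial m}} → gap + m ≡ n → m Rough n →
           ∃[ p ] (Prime p × p ∣ n × p Rough n)
  search m gap gap+m≡n m-rough with m ∣? n
  ... | yes m∣n = m , rough∧∣⇒prime m-rough m∣n , m∣n , m-rough
  search m zero refl m-rough | no m∤n = contradiction ∣-refl m∤n
  search m@(2+ _) (suc gap) gap+m≡n m-rough | no m∤n =
    search (suc m) gap (trans (+-suc gap m) gap+m≡n) (∤⇒rough-suc m∤n m-rough)

∃p^a*m≡n : ∀ p .{{_ : NonTrivial p}} n .{{_ : NonZero n}} → ∃[ a ] ∃[ m ] (p ∤ m × n ≡ p ^ a * m)
∃p^a*m≡n p n = <-rec Decomposable split n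
  where
  Decomposable : ℕ → Set
  Decomposable n = .{{NonZero n}} → ∃[ a ] ∃[ m ] (p ∤ m × n ≡ p ^ a * m)
  split : ∀ n → (∀ {n′} → n′ < n → Decomposable n′) → Decomposable n
  split n rec with p ∣? n
  ... | no p∤n = 0 , n , p∤n , sym (*-identityˡ n)
  ... | yes p∣n with rec (quotient-< p∣n) {{quotient≢0 p∣n}}
  ...   | a , m , p∤m , q≡p^a*m = suc a , m , p∤m , (begin
    n                 ≡⟨ m∣n⇒n≡m*quotient p∣n ⟩
    p * quotient p∣n  ≡⟨ cong (p *_) q≡p^a*m ⟩
    p * (p ^ a * m)   ≡⟨ *-assoc p (p ^ a) m ⟨
    p ^ suc a * m     ∎)
    where open ≡-Reasoning

^-distribʳ-* : ∀ m n o → (m * n) ^ o ≡ m ^ o * n ^ o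
^-distribʳ-* m n zero    = refl
^-distribʳ-* m n (suc o) = begin
  m * n * (m * n) ^ o         ≡⟨ cong (m * n *_) (^-distribʳ-* m n o) ⟩
  m * n * (m ^ o * n ^ o)     ≡⟨ *-interchange m n (m ^ o) (n ^ o) ⟩
  m * m ^ o * (n * n ^ o)     ∎
  where open ≡-Reasoning

m≤n⇒x^m∣x^n : ∀ x {m n} → m ≤ n → x ^ m ∣ x ^ n
m≤n⇒x^m∣x^n x {m} {n} m≤n = divides (x ^ (n ∸ m)) (begin
  x ^ n                 ≡⟨ cong (x ^_) (m∸n+n≡m m≤n) ⟨
  x ^ (n ∸ m + m)       ≡⟨ ^-distribˡ-+-* x (n ∸ m) m ⟩
  x ^ (n ∸ m) * x ^ m   ∎)
  where open ≡-Reasoning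

[x^c*y]^k*x^v≡y^k*x^[c*k+v] : ∀ x y c k v → (x ^ c * y) ^ k * x ^ v ≡ y ^ k * x ^ (c * k + v)
[x^c*y]^k*x^v≡y^k*x^[c*k+v] x y c k v = begin
  (x ^ c * y) ^ k * x ^ v           ≡⟨ cong (_* x ^ v) (^-distribʳ-* (x ^ c) y k) ⟩
  (x ^ c) ^ k * y ^ k * x ^ v       ≡⟨ cong (λ z → z * y ^ k * x ^ v) (^-*-assoc x c k) ⟩
  x ^ (c * k) * y ^ k * x ^ v       ≡⟨ rearrange (x ^ (c * k)) (y ^ k) (x ^ v) ⟩
  y ^ k * (x ^ (c * k) * x ^ v)     ≡⟨ cong (y ^ k *_) (^-distribˡ-+-* x (c * k) v) ⟨
  y ^ k * x ^ (c * k + v)           ∎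
  where
  open ≡-Reasoning
  rearrange : ∀ a b c → a * b * c ≡ b * (a * c)
  rearrange = solve-∀

1+n≤2^n : ∀ n → suc n ≤ 2 ^ n
1+n≤2^n zero    = ≤-refl
1+n≤2^n (suc n) = +-mono-≤ (m^n>0 2 n) (subst (suc n ≤_) (sym (+-identityʳ (2 ^ n))) (1+n≤2^n n))

record RootDivisor (k q n : ℕ) : Set where
  field
    d u           : ℕ
    d∣n           : d ∣ n
    u<k           : u < k
    d^k*q^u≤n     : d ^ k * q ^ u ≤ n
    τn≤2^u*τd^k³ : τ n ≤ 2 ^ u * τ d ^ (k * k * k)

module _ {k : ℕ} (2≤k : 2 ≤ k) where

  private instance
    k≢0 : NonZero k
    k≢0 = >-nonZero (≤-trans z<s 2≤k)

  1+k+k≤k*k*k : suc k + k ≤ k * k * k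
  1+k+k≤k*k*k = begin
    suc k + k         ≤⟨ +-monoˡ-≤ k (+-monoˡ-≤ k (≤-trans z<s 2≤k)) ⟩
    k + k + k         ≤⟨ m≤m+n (k + k + k) k ⟩
    k + k + k + k     ≡⟨ k+k+k+k≡2*2*k k ⟩
    2 * 2 * k         ≤⟨ *-monoˡ-≤ k (*-mono-≤ 2≤k 2≤k) ⟩
    k * k * k         ∎
    where
    open ≤-Reasoning
    k+k+k+k≡2*2*k : ∀ k → k + k + k + k ≡ 2 * 2 * k
    k+k+k+k≡2*2*k = solve-∀

  [u+a]/k≤a : ∀ {u} a → u < k → (u + a) / k ≤ a
  [u+a]/k≤a {u} a u<k = s≤s⁻¹ (*-cancelʳ-< k _ _ (begin-strict
    (u + a) / k * k                   ≤⟨ m≤n+m _ ((u + a) % k) ⟩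
    (u + a) % k + (u + a) / k * k     ≡⟨ m≡m%n+[m/n]*n (u + a) k ⟨
    u + a                             <⟨ +-monoˡ-< a u<k ⟩
    k + a                             ≤⟨ +-monoʳ-≤ k (m≤m*n a k) ⟩
    suc a * k                         ∎))
    where open ≤-Reasoning

  [1+a]*2^u≤2^u′*[1+c]^k³ : ∀ {u a u′} c → u < k → u′ < k → u + a ≡ u′ + c * k →
                           suc a * 2 ^ u ≤ 2 ^ u′ * suc c ^ (k * k * k)
  [1+a]*2^u≤2^u′*[1+c]^k³ {u} {a} {u′} zero _ _ u+a≡u′ = begin
    suc a * 2 ^ u               ≤⟨ *-monoˡ-≤ (2 ^ u) (1+n≤2^n a) ⟩
    2 ^ a * 2 ^ u               ≡⟨ ^-distribˡ-+-* 2 a u ⟨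
    2 ^ (a + u)                 ≡⟨ cong (2 ^_) (trans (+-comm a u) (trans u+a≡u′ (+-identityʳ u′))) ⟩
    2 ^ u′                      ≡⟨ *-identityʳ (2 ^ u′) ⟨
    2 ^ u′ * 1                  ≡⟨ cong (2 ^ u′ *_) (^-zeroˡ (k * k * k)) ⟨
    2 ^ u′ * 1 ^ (k * k * k)    ∎
    where open ≤-Reasoning
  [1+a]*2^u≤2^u′*[1+c]^k³ {u} {a} {u′} c@(suc c′) u<k u′<k u+a≡u′+ck = begin
    suc a * 2 ^ u               ≤⟨ *-mono-≤ 1+a≤C*k (^-monoʳ-≤ 2 (<⇒≤ u<k)) ⟩
    C * k * 2 ^ k               ≤⟨ *-mono-≤ (*-monoʳ-≤ C k≤C^k) 2^k≤C^k ⟩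
    C * C ^ k * C ^ k           ≡⟨ ^-distribˡ-+-* C (suc k) k ⟨
    C ^ (suc k + k)             ≤⟨ ^-monoʳ-≤ C 1+k+k≤k*k*k ⟩
    C ^ (k * k * k)             ≤⟨ m≤n*m (C ^ (k * k * k)) (2 ^ u′) {{m^n≢0 2 u′}} ⟩
    2 ^ u′ * C ^ (k * k * k)    ∎
    where
    open ≤-Reasoning
    C = suc c
    2^k≤C^k : 2 ^ k ≤ C ^ k
    2^k≤C^k = ^-monoˡ-≤ k (s≤s (s≤s z≤n))
    k≤C^k : k ≤ C ^ k
    k≤C^k = ≤-trans (≤-trans (n≤1+n k) (1+n≤2^n k)) 2^k≤C^k
    1+a≤C*k : suc a ≤ C * k
    1+a≤C*k = begin
      suc a             ≤⟨ s≤s (m≤n+m a u) ⟩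
      suc (u + a)       ≡⟨ cong suc u+a≡u′+ck ⟩
      suc u′ + c * k    ≤⟨ +-monoˡ-≤ (c * k) u′<k ⟩
      C * k             ∎

  rootDivisor[1] : ∀ q → RootDivisor k q 1
  rootDivisor[1] q = record
    { d = 1 ; u = 0 ; d∣n = ∣-refl ; u<k = ≤-trans z<s 2≤k
    ; d^k*q^u≤n    = ≤-reflexive (cong (_* 1) (^-zeroˡ k))
    ; τn≤2^u*τd^k³ = ≤-reflexive (cong (_+ 0) (sym (^-zeroˡ (k * k * k))))
    }

  extend : ∀ {p m q} → Prime p → p ∤ m → q ≤ p → RootDivisor k p m → ∀ a → RootDivisor k q (p ^ a * m)
  extend {p} {m} {q} p-prime p∤m q≤p r a = record
    { d = p ^ c * d ; u = u′ ; d∣n = *-pres-∣ p^c∣p^a d∣n ; u<k = m%n<n (u + a) k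
    ; d^k*q^u≤n = d′^k*q^u′≤n ; τn≤2^u*τd^k³ = τn≤2^u′*τd′^k³ }
    where
    open RootDivisor r
    instance
      p≢0 : NonZero p
      p≢0 = prime⇒nonZero p-prime
    c u′ E : ℕ
    c  = (u + a) / k
    u′ = (u + a) % k
    E  = k * k * k
    u+a≡u′+c*k : u + a ≡ u′ + c * k
    u+a≡u′+c*k = m≡m%n+[m/n]*n (u + a) k
    p^c∣p^a : p ^ c ∣ p ^ a
    p^c∣p^a = m≤n⇒x^m∣x^n p ([u+a]/k≤a a u<k)
    d′^k*q^u′≤n : (p ^ c * d) ^ k * q ^ u′ ≤ p ^ a * m
    d′^k*q^u′≤n = begin
      (p ^ c * d) ^ k * q ^ u′     ≤⟨ *-monoʳ-≤ ((p ^ c * d) ^ k) (^-monoˡ-≤ u′ q≤p) ⟩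
      (p ^ c * d) ^ k * p ^ u′     ≡⟨ [x^c*y]^k*x^v≡y^k*x^[c*k+v] p d c k u′ ⟩
      d ^ k * p ^ (c * k + u′)     ≡⟨ cong (λ e → d ^ k * p ^ e) (trans (+-comm (c * k) u′) (sym u+a≡u′+c*k)) ⟩
      d ^ k * p ^ (u + a)          ≡⟨ cong (d ^ k *_) (^-distribˡ-+-* p u a) ⟩
      d ^ k * (p ^ u * p ^ a)      ≡⟨ *-assoc (d ^ k) (p ^ u) (p ^ a) ⟨
      d ^ k * p ^ u * p ^ a        ≤⟨ *-monoˡ-≤ (p ^ a) d^k*q^u≤n ⟩
      m * p ^ a                    ≡⟨ *-comm m (p ^ a) ⟩
      p ^ a * m                    ∎
      where open ≤-Reasoning
    τn≤2^u′*τd′^k³ : τ (p ^ a * m) ≤ 2 ^ u′ * τ (p ^ c * d) ^ E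
    τn≤2^u′*τd′^k³ = begin
      τ (p ^ a * m)                ≡⟨ τ[p^am] p-prime p∤m a ⟩
      suc a * τ m                  ≤⟨ *-monoʳ-≤ (suc a) τn≤2^u*τd^k³ ⟩
      suc a * (2 ^ u * τ d ^ E)    ≡⟨ *-assoc (suc a) (2 ^ u) (τ d ^ E) ⟨
      suc a * 2 ^ u * τ d ^ E      ≤⟨ *-monoˡ-≤ (τ d ^ E) ([1+a]*2^u≤2^u′*[1+c]^k³ c u<k (m%n<n (u + a) k) u+a≡u′+c*k) ⟩
      2 ^ u′ * suc c ^ E * τ d ^ E ≡⟨ *-assoc (2 ^ u′) (suc c ^ E) (τ d ^ E) ⟩
      2 ^ u′ * (suc c ^ E * τ d ^ E) ≡⟨ cong (2 ^ u′ *_) (^-distribʳ-* (suc c) (τ d) E) ⟨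
      2 ^ u′ * (suc c * τ d) ^ E   ≡⟨ cong (λ t → 2 ^ u′ * t ^ E) (τ[p^am] p-prime (λ p∣d → p∤m (∣-trans p∣d d∣n)) c) ⟨
      2 ^ u′ * τ (p ^ c * d) ^ E   ∎
      where open ≤-Reasoning

  rootDivisor : ∀ n .{{_ : NonZero n}} q → q Rough n → RootDivisor k q n
  rootDivisor = <-rec HasRootDivisor go
    where
    HasRootDivisor : ℕ → Set
    HasRootDivisor n = .{{NonZero n}} → ∀ q → q Rough n → RootDivisor k q n
    go : ∀ n → (∀ {n′} → n′ < n → HasRootDivisor n′) → HasRootDivisor n
    go 1 _ q _ = rootDivisor[1] q
    go n@(2+ _) rec q q-rough with leastPrimeFactor n
    ... | p , p-prime , p∣n , p-rough with ∃p^a*m≡n p {{prime⇒nonTrivial p-prime}} n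
    ...   | a , m , p∤m , n≡p^a*m =
      subst (RootDivisor k q) (sym n≡p^a*m)
            (extend p-prime p∤m q≤p (rec m<n {{∤⇒nonZero p∤m}} p (rough∧∣⇒rough p-rough m∣n)) a)
      where
      m∣n : m ∣ n
      m∣n = divides (p ^ a) n≡p^a*m
      m<n : m < n
      m<n = ≤∧≢⇒< (∣⇒≤ m∣n) (λ { refl → p∤m p∣n })
      q≤p : q ≤ p
      q≤p = rough⇒≤ {{prime⇒nonTrivial p-prime}} (rough∧∣⇒rough q-rough p∣n)

lemma2p4 : ∀ (n k : ℕ) → .{{NonZero n}} → 2 ≤ k →
    ∃[ d ] (d ∣ n × d ^ k ≤ n × τ n ≤ 2 ^ (k * k) * τ d ^ (k * k * k))
lemma2p4 n k 2≤k = d , d∣n , d^k≤n , τn≤2^[k*k]*τd^k³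
  where
  open RootDivisor (rootDivisor 2≤k n 1 1-rough)
  instance
    k≢0 : NonZero k
    k≢0 = >-nonZero (≤-trans z<s 2≤k)
  d^k≤n : d ^ k ≤ n
  d^k≤n = subst (_≤ n) (trans (cong (d ^ k *_) (^-zeroˡ u)) (*-identityʳ (d ^ k))) d^k*q^u≤n
  τn≤2^[k*k]*τd^k³ : τ n ≤ 2 ^ (k * k) * τ d ^ (k * k * k)
  τn≤2^[k*k]*τd^k³ = ≤-trans τn≤2^u*τd^k³
    (*-monoˡ-≤ (τ d ^ (k * k * k)) (^-monoʳ-≤ 2 (≤-trans (<⇒≤ u<k) (m≤m*n k k))))
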